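{- Let $d\geq1$. A sequence of priorities $p_1,p_2,\dots,p_k\in\{1,\dots,d\}$ (with $k\geq1$) fulfils a declaration $r\in D_d$ if and only if the sequence $p_2,\dots,p_k$ fulfils the declaration $r{\restriction}_{p_1}$.
   Context: The order $\preceq$ on positive integers is $\dots\preceq5\preceq3\preceq1\preceq2\preceq4\preceq6\preceq\dots$ (odd numbers in decreasing order, followed by even numbers in increasing order); "worse" means earlier in this order. The set of declarations is $D_d=\{1,\dots,d,2d\}$. For $p\in\{1,\dots,d\}$ and $r\in D_d$ the shifted declaration is $r{\restriction}_p=p+1$ if $p$ is odd and $p>r$; $r{\restriction}_p=p-1$ if $p$ is even and $p\geq r$; and $r{\restriction}_p=r$ otherwise. The leader of a finite sequence of priorities is its greatest element, or $1$ if the sequence is empty. A sequence fulfils a declaration $r$ if $r\preceq$ (the leader of the sequence). -}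

module Defs where

open import Data.Nat using (ℕ; zero; suc; _+_; _*_; _≤_; _<_; _≥_; _⊔_; _≤ᵇ_; _<ᵇ_; _≡ᵇ_; _∸_)
open import Data.Nat.Base using (_%_)
open import Data.List using (List; []; _∷_)
open import Data.Bool using (Bool; true; false; if_then_else_)
open import Data.Product using (_×_)
open import Data.Sum using (_⊎_)
open import Relation.Binary.PropositionalEquality using (_≡_)

Even : ℕ → Set
Even n = n % 2 ≡ 0

Odd : ℕ → Set
Odd n = n % 2 ≡ 1

-- The order ⪯ on positive integers:
-- ... ⪯ 5 ⪯ 3 ⪯ 1 ⪯ 2 ⪯ 4 ⪯ 6 ⪯ ...
_⪯_ : ℕ → ℕ → Set
m ⪯ n = (Odd m × Odd n × n ≤ m) ⊎ (Odd m × Even n) ⊎ (Even m × Even n × m ≤ n)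

isOdd : ℕ → Bool
isOdd n = (n % 2) ≡ᵇ 1

_↾_ : ℕ → ℕ → ℕ
r ↾ p = if isOdd p
          then (if r <ᵇ p then suc p else r)
          else (if r ≤ᵇ p then p ∸ 1 else r)

leader : List ℕ → ℕ
leader [] = 1
leader (p ∷ ps) = p ⊔ leader ps

Fulfils : List ℕ → ℕ → Set
Fulfils ps r = r ⪯ leader ps

IsPriority : ℕ → ℕ → Set
IsPriority d p = 1 ≤ p × p ≤ d

IsDeclaration : ℕ → ℕ → Set
IsDeclaration d r = (1 ≤ r × r ≤ d) ⊎ r ≡ 2 * d

-- Write L for the leader of the tail, so that the sequence fulfils r iff r ⪯ p ⊔ L.
-- Between numbers of different size, ⪯ is decided by the parity of the larger one:
-- for m < n, m ⪯ n iff n is even and n ⪯ m iff n is odd. Hence a declaration r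
-- above p (or r = p odd) judges p ⊔ L exactly as it judges L, and the shift leaves
-- it alone; a declaration below p (or r = p even) is fulfilled iff p ⊔ L is even,
-- which is precisely what the shifted declaration p + 1 (p odd) or p − 1 (p even)
-- demands of L.
module Submission where

open import Defs
open import Data.Nat using (ℕ; _≤_)
open import Data.List using (List; _∷_)
open import Data.List.Relation.Unary.All using (All)
open import Function.Bundles using (_⇔_)

open import Data.Nat using (suc; _+_; _<_; _⊔_; _<ᵇ_; _≤ᵇ_; _∸_; _%_; s≤s)
open import Data.Nat.Properties
open import Data.Nat.DivMod using (m%n<n; %-distribˡ-+)
open import Data.Bool using (true; false)
open import Data.Product using (_×_; _,_; proj₁; proj₂)
open import Data.Sum using (_⊎_; inj₁; inj₂)
open import Function.Bundles using (Equivalence; mk⇔)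
open import Function.Properties.Equivalence using () renaming (refl to ⇔-refl; trans to ⇔-trans; sym to ⇔-sym)
open import Relation.Binary.PropositionalEquality using (_≡_; refl; sym; trans; cong)
open import Relation.Nullary using (¬_; contradiction)
open import Relation.Nullary.Reflects using (ofʸ; ofⁿ)

private
  variable
    m n p r L : ℕ

parity : ∀ n → Even n ⊎ Odd n
parity n with n % 2 | m%n<n n 2
... | 0 | _ = inj₁ refl
... | 1 | _ = inj₂ refl
... | suc (suc _) | s≤s (s≤s ())

even⇒¬odd : ∀ n → Even n → ¬ Odd n
even⇒¬odd _ e o with trans (sym e) o
... | ()

[1+n]%2≡[1+n%2]%2 : ∀ n → suc n % 2 ≡ (1 + n % 2) % 2
[1+n]%2≡[1+n%2]%2 n = %-distribˡ-+ 1 n 2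

odd⇒even-suc : ∀ n → Odd n → Even (suc n)
odd⇒even-suc n o = trans ([1+n]%2≡[1+n%2]%2 n) (cong (λ k → (1 + k) % 2) o)

even⇒odd-suc : ∀ n → Even n → Odd (suc n)
even⇒odd-suc n e = trans ([1+n]%2≡[1+n%2]%2 n) (cong (λ k → (1 + k) % 2) e)

even-suc⇒odd : ∀ n → Even (suc n) → Odd n
even-suc⇒odd n e with parity n
... | inj₁ e′ = contradiction (even⇒odd-suc n e′) (even⇒¬odd (suc n) e)
... | inj₂ o  = o

even-⪯ : Even m → m ⪯ n ⇔ (Even n × m ≤ n)
even-⪯ {m} {n} e = mk⇔ to (λ (e′ , m≤n) → inj₂ (inj₂ (e , e′ , m≤n)))
  where
  to : m ⪯ n → Even n × m ≤ n
  to (inj₁ (o , _ , _))          = contradiction o (even⇒¬odd m e)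
  to (inj₂ (inj₁ (o , _)))       = contradiction o (even⇒¬odd m e)
  to (inj₂ (inj₂ (_ , e′ , m≤n))) = e′ , m≤n

odd-⪯ : Odd m → m ⪯ n ⇔ (Even n ⊎ n ≤ m)
odd-⪯ {m} {n} o = mk⇔ to from
  where
  to : m ⪯ n → Even n ⊎ n ≤ m
  to (inj₁ (_ , _ , n≤m))    = inj₂ n≤m
  to (inj₂ (inj₁ (_ , e)))   = inj₁ e
  to (inj₂ (inj₂ (e , _ , _))) = contradiction o (even⇒¬odd m e)

  from : Even n ⊎ n ≤ m → m ⪯ n
  from (inj₁ e) = inj₂ (inj₁ (o , e))
  from (inj₂ n≤m) with parity n
  ... | inj₁ e  = inj₂ (inj₁ (o , e))
  ... | inj₂ o′ = inj₁ (o , o′ , n≤m)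

≤⇒⪯-even : Even n → m ≤ n → m ⪯ n
≤⇒⪯-even {m = m} e m≤n with parity m
... | inj₁ e′ = inj₂ (inj₂ (e′ , e , m≤n))
... | inj₂ o  = inj₂ (inj₁ (o , e))

<⇒⪯⇔Even : m < n → m ⪯ n ⇔ Even n
<⇒⪯⇔Even {m} {n} m<n with parity m
... | inj₁ e = ⇔-trans (even-⪯ e) (mk⇔ proj₁ (_, <⇒≤ m<n))
... | inj₂ o = ⇔-trans (odd-⪯ o) (mk⇔ to inj₁)
  where
  to : Even n ⊎ n ≤ m → Even n
  to (inj₁ e)   = e
  to (inj₂ n≤m) = contradiction n≤m (<⇒≱ m<n)

>⇒⪯⇔Odd : n < m → m ⪯ n ⇔ Odd m
>⇒⪯⇔Odd {n} {m} n<m with parity m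
... | inj₁ e = mk⇔ (λ m⪯n → contradiction (proj₂ (Equivalence.to (even-⪯ e) m⪯n)) (<⇒≱ n<m))
                   (λ o → contradiction o (even⇒¬odd m e))
... | inj₂ o = mk⇔ (λ _ → o) (λ _ → Equivalence.from (odd-⪯ o) (inj₂ (<⇒≤ n<m)))

<⇒⪯-⊔⇔⪯ : p < r → r ⪯ (p ⊔ L) ⇔ r ⪯ L
<⇒⪯-⊔⇔⪯ {p} {L = L} p<r with ≤-<-connex L p
... | inj₁ L≤p rewrite m≥n⇒m⊔n≡m L≤p =
  ⇔-trans (>⇒⪯⇔Odd p<r) (⇔-sym (>⇒⪯⇔Odd (≤-<-trans L≤p p<r)))
... | inj₂ p<L rewrite m≤n⇒m⊔n≡n (<⇒≤ p<L) = ⇔-refl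

odd⇒⪯-⊔⇔⪯ : Odd p → p ⪯ (p ⊔ L) ⇔ p ⪯ L
odd⇒⪯-⊔⇔⪯ {p} {L} o with ≤-<-connex L p
... | inj₁ L≤p rewrite m≥n⇒m⊔n≡m L≤p =
  mk⇔ (λ _ → Equivalence.from (odd-⪯ o) (inj₂ L≤p))
      (λ _ → Equivalence.from (odd-⪯ o) (inj₂ ≤-refl))
... | inj₂ p<L rewrite m≤n⇒m⊔n≡n (<⇒≤ p<L) = ⇔-refl

≤-even⇒⪯-⊔⇔Even : Even p → r ≤ p → r ⪯ (p ⊔ L) ⇔ Even (p ⊔ L)
≤-even⇒⪯-⊔⇔Even {p} {L = L} e r≤p with ≤-<-connex L p
... | inj₁ L≤p rewrite m≥n⇒m⊔n≡m L≤p = mk⇔ (λ _ → e) (λ _ → ≤⇒⪯-even e r≤p)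
... | inj₂ p<L rewrite m≤n⇒m⊔n≡n (<⇒≤ p<L) = <⇒⪯⇔Even (≤-<-trans r≤p p<L)

odd⇒suc⪯⇔Even-⊔ : Odd p → suc p ⪯ L ⇔ Even (p ⊔ L)
odd⇒suc⪯⇔Even-⊔ {p} {L} o with ≤-<-connex L p
... | inj₁ L≤p rewrite m≥n⇒m⊔n≡m L≤p =
  mk⇔ (λ p+1⪯L → contradiction (Equivalence.to (>⇒⪯⇔Odd (s≤s L≤p)) p+1⪯L)
                                (even⇒¬odd (suc p) (odd⇒even-suc p o)))
      (λ e → contradiction o (even⇒¬odd p e))
... | inj₂ p<L rewrite m≤n⇒m⊔n≡n (<⇒≤ p<L) =
  ⇔-trans (even-⪯ (odd⇒even-suc p o)) (mk⇔ proj₁ (_, p<L))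

even⇒pred⪯⇔Even-⊔ : Even p → 1 ≤ p → (p ∸ 1) ⪯ L ⇔ Even (p ⊔ L)
even⇒pred⪯⇔Even-⊔ {suc q} {L} e _ with ≤-<-connex L (suc q)
... | inj₁ L≤p rewrite m≥n⇒m⊔n≡m L≤p =
  mk⇔ (λ _ → e) (λ _ → Equivalence.from (odd-⪯ (even-suc⇒odd q e)) q-bound)
  where
  q-bound : Even L ⊎ L ≤ q
  q-bound with m≤n⇒m<n∨m≡n L≤p
  ... | inj₁ (s≤s L≤q) = inj₂ L≤q
  ... | inj₂ refl      = inj₁ e
... | inj₂ p<L rewrite m≤n⇒m⊔n≡n (<⇒≤ p<L) = <⇒⪯⇔Even (<-trans (n<1+n q) p<L)

⪯-⊔⇔↾⪯ : 1 ≤ p → r ⪯ (p ⊔ L) ⇔ (r ↾ p) ⪯ L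
-- Rewriting with the parity equation p % 2 ≡ _ evaluates the test isOdd p inside r ↾ p.
⪯-⊔⇔↾⪯ {p} {r} {L} 1≤p with parity p
... | inj₂ o rewrite o with r <ᵇ p | <ᵇ-reflects-< r p
...   | true  | ofʸ r<p = ⇔-trans (<⇒⪯⇔Even (≤-trans r<p (m≤m⊔n p L))) (⇔-sym (odd⇒suc⪯⇔Even-⊔ o))
...   | false | ofⁿ r≮p with m≤n⇒m<n∨m≡n (≮⇒≥ r≮p)
...     | inj₁ p<r  = <⇒⪯-⊔⇔⪯ p<r
...     | inj₂ refl = odd⇒⪯-⊔⇔⪯ o
⪯-⊔⇔↾⪯ {p} {r} {L} 1≤p | inj₁ e rewrite e with r ≤ᵇ p | ≤ᵇ-reflects-≤ r p
...   | true  | ofʸ r≤p = ⇔-trans (≤-even⇒⪯-⊔⇔Even e r≤p) (⇔-sym (even⇒pred⪯⇔Even-⊔ e 1≤p))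
...   | false | ofⁿ r≰p = <⇒⪯-⊔⇔⪯ (≰⇒> r≰p)

lemma3p2 : (d : ℕ) → 1 ≤ d → (p₁ : ℕ) → (ps : List ℕ) → (r : ℕ)
         → IsPriority d p₁ → All (IsPriority d) ps → IsDeclaration d r
         → Fulfils (p₁ ∷ ps) r ⇔ Fulfils ps (r ↾ p₁)
lemma3p2 _ _ _ _ _ (1≤p₁ , _) _ _ = ⪯-⊔⇔↾⪯ 1≤p₁
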